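{- If a finite tree $T$ of order $n \ge 4$ has a redundant identifying code, then $\left\lceil \tfrac{4}{5}(n+1) \right\rceil \le \mathrm{RED{:}IC}(T) \le n$.
   Context: $N[v]$ denotes the closed neighborhood of $v$ and $\Delta$ symmetric difference. A set $S \subseteq V(T)$ is a redundant identifying code if every vertex $v$ satisfies $|N[v] \cap S| \ge 2$ and every pair of distinct vertices $u,v$ satisfies $|(N[u]\cap S)\,\Delta\,(N[v]\cap S)| \ge 2$; $\mathrm{RED{:}IC}(T)$ is the minimum cardinality of such a set. -}

module Defs where

open import Data.Nat using (ℕ; zero; suc; _+_; _*_; _≤_; _/_)
open import Data.Fin using (Fin)
open import Data.Fin.Subset using (Subset; _∩_; _∪_; _─_; ∣_∣; _∈_; inside; outside)
open import Data.Vec using (Vec; tabulate; []; _∷_)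
open import Data.List using (List; length)
open import Data.List.Relation.Unary.Unique.Propositional using (Unique)
open import Data.Product using (_×_; Σ; ∃)
open import Relation.Binary.PropositionalEquality using (_≡_)
open import Relation.Nullary using (¬_; Dec; yes; no)
open import Data.Sum using (_⊎_)

record Graph (n : ℕ) : Set₁ where
  field
    Adj   : Fin n → Fin n → Set
    adj?  : ∀ u v → Dec (Adj u v)
    sym   : ∀ {u v} → Adj u v → Adj v u
    irrefl : ∀ {u} → ¬ Adj u u

module _ {n : ℕ} (G : Graph n) where
  open Graph G

  data Walk : Fin n → Fin n → Set where
    here : ∀ {u} → Walk u u
    step : ∀ {u w v} → Adj u w → Walk w v → Walk u v

  Connected : Set
  Connected = ∀ u v → Walk u v

  data PathList : Fin n → Fin n → List (Fin n) → Set where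
    one  : ∀ {u} → PathList u u (u Data.List.∷ Data.List.[])
    cons : ∀ {u w v xs} → Adj u w → PathList w v xs → PathList u v (u Data.List.∷ xs)

  -- a cycle: distinct vertices x₀,…,xₖ with k ≥ 2, consecutive ones adjacent, and xₖ adjacent to x₀
  HasCycle : Set
  HasCycle = Σ (Fin n) λ u → Σ (Fin n) λ v → Σ (List (Fin n)) λ xs →
               PathList u v xs × Unique xs × (3 ≤ length xs) × Adj v u

  Acyclic : Set
  Acyclic = ¬ HasCycle

  IsTree : Set
  IsTree = Connected × Acyclic

  N[_] : Fin n → Subset n
  N[ v ] = tabulate λ u → decide u
    where
      decide : Fin n → Data.Fin.Subset.Side
      decide u with u Data.Fin.≟ v
      ... | yes _ = inside
      ... | no _ with adj? u v
      ...   | yes _ = inside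
      ...   | no _ = outside

  _Δ_ : Subset n → Subset n → Subset n
  A Δ B = (A ─ B) ∪ (B ─ A)

  IsRedundantIC : Subset n → Set
  IsRedundantIC S =
    (∀ v → 2 ≤ ∣ N[ v ] ∩ S ∣) ×
    (∀ u v → ¬ u ≡ v → 2 ≤ ∣ (N[ u ] ∩ S) Δ (N[ v ] ∩ S) ∣)

  HasRedundantIC : Set
  HasRedundantIC = Σ (Subset n) IsRedundantIC

  IsREDIC : ℕ → Set
  IsREDIC k = (Σ (Subset n) λ S → IsRedundantIC S × ∣ S ∣ ≡ k) ×
              (∀ S → IsRedundantIC S → k ≤ ∣ S ∣)

⌈_/5⌉ : ℕ → ℕ
⌈ m /5⌉ = (m + 4) / 5

module Submission where

-- Root the tree at a vertex r of the code S. Call a vertex t of S a top if t = r or the parent of t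
-- lies outside S; climbing from a vertex of S through S leads to a unique top. Below each top t lie
-- four vertices of S: t, a child a of t in S (t needs a second code neighbour), and two vertices of
-- (N[t] ∩ S) Δ (N[a] ∩ S), each a child of t or of a. Every vertex u ∉ S has a child in S (a code
-- neighbour other than its parent), which is a top, and different u give different tops. So the
-- clusters below r and below these children are disjoint: 4 (1 + (n - |S|)) ≤ |S|, i.e. 5 |S| ≥ 4 (n + 1).
-- The rooting comes from the depth from r: in a tree every edge joins a vertex to its parent, since
-- otherwise two distinct vertices of equal depth, joined below, together with their ancestors close a cycle.

open import Data.Empty using (⊥-elim)
open import Data.Fin as Fin using (Fin; _≟_)
open import Data.Fin.Properties using (any?)
open import Data.Fin.Subset using (Subset; _∈_; _∉_; _∩_; _─_; ∣_∣; ⁅_⁆; inside; outside)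
open import Data.Fin.Subset.Properties
  using (_∈?_; ∣p∣≤n; ∣⁅x⁆∣≡1; x∈⁅x⁆; x∈p∩q⁻; x∈p∩q⁺; x∈p∪q⁻; p─q⊆p; p⊆q⇒∣p∣≤∣q∣; x∈p⇒∣p-x∣<∣p∣; x∈p∧x≢y⇒x∈p-y)
open import Data.List using (List; []; _∷_; _++_; _∷ʳ_; length; filter; allFin)
open import Data.List.Membership.Propositional using () renaming (_∈_ to _∈ˡ_)
open import Data.List.Membership.Propositional.Properties using (∈-filter⁻)
open import Data.List.Properties using (length-++; length-tabulate)
open import Data.List.Relation.Unary.All using (All; []; _∷_)
import Data.List.Relation.Unary.All as All
import Data.List.Relation.Unary.All.Properties as Allₚ
open import Data.List.Relation.Unary.AllPairs using ([]; _∷_)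
open import Data.List.Relation.Unary.Any using (here; there)
open import Data.List.Relation.Unary.Unique.Propositional using (Unique)
open import Data.List.Relation.Unary.Unique.Propositional.Properties using (++⁺; filter⁺; allFin⁺)
open import Data.Nat using (ℕ; zero; suc; _+_; _*_; _≤_; _<_; z≤n; s≤s; s≤s⁻¹)
open import Data.Nat.DivMod using (m<n*o⇒m/o<n)
open import Data.Nat.Induction using (<-rec)
open import Data.Nat.Properties
  using ( ≤-refl; ≤-reflexive; ≤-trans; ≤-antisym; <⇒≤; <-irrefl; <-cmp; ≮⇒≥; 1+n≰n; n<1+n; n≤0⇒n≡0
        ; +-comm; +-suc; *-comm; *-zeroʳ; *-suc; +-monoˡ-≤; +-monoʳ-<; +-mono-≤; *-monoʳ-≤
        ; anyUpTo?; module ≤-Reasoning)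
open import Data.Nat.Tactic.RingSolver using (solve-∀)
open import Data.Product using (∃; ∃₂; _×_; _,_; proj₁; proj₂)
open import Data.Sum using (_⊎_; inj₁; inj₂)
open import Data.Vec using ([]; _∷_; here; there; lookup)
open import Data.Vec.Properties using (lookup∘tabulate; []=⇒lookup; lookup⇒[]=)
open import Function using (id)
open import Relation.Binary.Definitions using (Tri; tri<; tri≈; tri>)
open import Relation.Binary.PropositionalEquality using (_≡_; _≢_; refl; sym; trans; subst; cong; cong₂; ≢-sym)
open import Relation.Nullary using (¬_; Dec; yes; no; does)
open import Relation.Nullary.Decidable using (_×-dec_; _⊎-dec_; ¬?; dec-true)
open import Relation.Unary using (Decidable)
open import Relation.Unary.Properties using (∁?)

open import Defs

Least : (ℕ → Set) → Set
Least P = ∃ λ m → P m × (∀ {j} → P j → m ≤ j)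

least-witness : {P : ℕ → Set} → Decidable P → ∀ {k} → P k → Least P
least-witness {P} P? = <-rec (λ k → P k → Least P) search _
  where
    search : ∀ k → (∀ {j} → j < k → P j → Least P) → P k → Least P
    search k below Pk with anyUpTo? P? k
    ... | yes (j , j<k , Pj) = below j<k Pj
    ... | no none = k , Pk , λ {j} Pj → ≮⇒≥ λ j<k → none (j , j<k , Pj)

length-filter-∁ : ∀ {A : Set} {P : A → Set} (P? : Decidable P) (xs : List A) →
                  length (filter P? xs) + length (filter (∁? P?) xs) ≡ length xs
length-filter-∁ P? [] = refl
length-filter-∁ P? (x ∷ xs) with P? x
... | yes _ = cong suc (length-filter-∁ P? xs)
... | no _ = trans (+-suc _ _) (cong suc (length-filter-∁ P? xs))

unique-∷ʳ : ∀ {A : Set} {x : A} {xs} → Unique xs → All (_≢ x) xs → Unique (xs ∷ʳ x)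
unique-∷ʳ uxs xs≢x = ++⁺ uxs ([] ∷ []) λ { (y∈xs , here refl) → All.lookup xs≢x y∈xs refl }

x∈p─q⇒x∉q : ∀ {n} {p q : Subset n} {x} → x ∈ p ─ q → x ∉ q
x∈p─q⇒x∉q {p = _ ∷ _} {inside ∷ _} {Fin.zero} () _
x∈p─q⇒x∉q {p = _ ∷ _} {outside ∷ _} {Fin.zero} _ ()
x∈p─q⇒x∉q {p = _ ∷ p} {_ ∷ q} {Fin.suc x} (there x∈) (there x∈q) = x∈p─q⇒x∉q {p = p} {q} x∈ x∈q

another-element : ∀ {n} (A : Subset n) → 2 ≤ ∣ A ∣ → (c : Fin n) → ∃ λ y → y ∈ A × y ≢ c
another-element A 2≤∣A∣ c with any? (λ y → (y ∈? A) ×-dec ¬? (y ≟ c))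
... | yes found = found
... | no none = ⊥-elim (1+n≰n (≤-trans 2≤∣A∣ (subst (∣ A ∣ ≤_) (∣⁅x⁆∣≡1 c) (p⊆q⇒∣p∣≤∣q∣ A⊆⁅c⁆))))
  where
    A⊆⁅c⁆ : ∀ {y} → y ∈ A → y ∈ ⁅ c ⁆
    A⊆⁅c⁆ {y} y∈A with y ≟ c
    ... | yes refl = x∈⁅x⁆ c
    ... | no y≢c = ⊥-elim (none (y , y∈A , y≢c))

distinct-pair : ∀ {n} (A : Subset n) → 2 ≤ ∣ A ∣ → ∃₂ λ y z → y ∈ A × z ∈ A × y ≢ z
distinct-pair [] ()
distinct-pair A@(_ ∷ _) 2≤∣A∣ with another-element A 2≤∣A∣ Fin.zero
... | y , y∈A , _ with another-element A 2≤∣A∣ y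
...   | z , z∈A , z≢y = y , z , y∈A , z∈A , ≢-sym z≢y

unique⇒length≤∣p∣ : ∀ {n} {p : Subset n} {xs} → Unique xs → All (_∈ p) xs → length xs ≤ ∣ p ∣
unique⇒length≤∣p∣ {xs = []} _ _ = z≤n
unique⇒length≤∣p∣ {xs = x ∷ xs} (x∉xs ∷ uxs) (x∈p ∷ xs⊆p) =
  ≤-trans (s≤s (unique⇒length≤∣p∣ uxs (All.zipWith (λ (y∈p , x≢y) → x∈p∧x≢y⇒x∈p-y y∈p (≢-sym x≢y)) (xs⊆p , x∉xs))))
          (x∈p⇒∣p-x∣<∣p∣ x∈p)

⌈/5⌉-least : ∀ {m s} → m ≤ 5 * s → ⌈ m /5⌉ ≤ s
⌈/5⌉-least {m} {s} m≤5s = s≤s⁻¹ (m<n*o⇒m/o<n (begin-strict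
  m + 4      <⟨ +-monoʳ-< m (n<1+n 4) ⟩
  m + 5      ≤⟨ +-monoˡ-≤ 5 m≤5s ⟩
  5 * s + 5  ≡⟨ +-comm (5 * s) 5 ⟩
  5 + 5 * s  ≡⟨ cong (5 +_) (*-comm 5 s) ⟩
  suc s * 5  ∎))
  where open ≤-Reasoning

module Ascent {A : Set} (up : A → A) (Stop : A → Set) where

  data _⇝_ : A → A → Set where
    stop  : ∀ {x} → x ⇝ x
    climb : ∀ {x y} → ¬ Stop x → up x ⇝ y → x ⇝ y

  ⇝-functional : ∀ {x y z} → x ⇝ y → x ⇝ z → Stop y → Stop z → y ≡ z
  ⇝-functional stop stop _ _ = refl
  ⇝-functional stop (climb ¬Sx _) Sx _ = ⊥-elim (¬Sx Sx)
  ⇝-functional (climb ¬Sx _) stop _ Sx = ⊥-elim (¬Sx Sx)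
  ⇝-functional (climb _ p) (climb _ q) Sy Sz = ⇝-functional p q Sy Sz

module _ {n : ℕ} (G : Graph n) where
  open Graph G renaming (sym to adj-sym)

  adj⇒≢ : ∀ {x y} → Adj x y → x ≢ y
  adj⇒≢ a refl = irrefl a

  -- The tabulated helper inside N[_] cannot be named; lookup∘tabulate exposes it to with-abstraction.
  lookup-N[] : ∀ x v → lookup (N[_] G v) x ≡ does ((x ≟ v) ⊎-dec adj? x v)
  lookup-N[] x v with lookup (N[_] G v) x in eq
  ... | b with trans (sym (lookup∘tabulate _ x)) eq
  ...   | neighbour≡b with x ≟ v
  ...     | yes _ = sym neighbour≡b
  ...     | no _ with adj? x v
  ...       | yes _ = sym neighbour≡b
  ...       | no _ = sym neighbour≡b

  ∈N[]⁻ : ∀ {x v} → x ∈ N[_] G v → x ≡ v ⊎ Adj x v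
  ∈N[]⁻ {x} {v} x∈ with x ≟ v | adj? x v | lookup-N[] x v
  ... | yes x≡v | _ | _ = inj₁ x≡v
  ... | no _ | yes a | _ = inj₂ a
  ... | no _ | no _ | lookup≡outside with trans (sym lookup≡outside) ([]=⇒lookup x∈)
  ...   | ()

  ∈N[]⁺ : ∀ {x v} → x ≡ v ⊎ Adj x v → x ∈ N[_] G v
  ∈N[]⁺ {x} {v} h = lookup⇒[]= x _ (trans (lookup-N[] x v) (dec-true ((x ≟ v) ⊎-dec adj? x v) h))

  pathList-∷ʳ : ∀ {u v w xs} → PathList G u v xs → Adj v w → PathList G u w (xs ∷ʳ w)
  pathList-∷ʳ one a = cons a one
  pathList-∷ʳ (cons b p) a = cons b (pathList-∷ʳ p a)

  pathList-length : ∀ {u v xs} → PathList G u v xs → u ≢ v → 2 ≤ length xs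
  pathList-length one u≢u = ⊥-elim (u≢u refl)
  pathList-length (cons _ one) _ = s≤s (s≤s z≤n)
  pathList-length (cons _ (cons _ _)) _ = s≤s (s≤s z≤n)

  record Rooting (r : Fin n) : Set where
    field
      parent      : Fin n → Fin n
      parent-root : parent r ≡ r
      parent-edge : ∀ {x y} → Adj x y → parent x ≡ y ⊎ parent y ≡ x

  module Depth (connected : Connected G) (r : Fin n) where

    Within : ℕ → Fin n → Set
    Within zero v = v ≡ r
    Within (suc k) v = Within k v ⊎ ∃ λ w → Within k w × Adj w v

    within? : ∀ k v → Dec (Within k v)
    within? zero v = v ≟ r
    within? (suc k) v = within? k v ⊎-dec any? (λ w → within? k w ×-dec adj? w v)

    within-walk : ∀ {k u v} → Within k u → Walk G u v → ∃ λ m → Within m v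
    within-walk w here = _ , w
    within-walk w (step a p) = within-walk (inj₂ (_ , w , a)) p

    least-depth : ∀ v → Least (λ k → Within k v)
    least-depth v = least-witness (λ k → within? k v) (proj₂ (within-walk {0} refl (connected r v)))

    depth : Fin n → ℕ
    depth v = proj₁ (least-depth v)

    within-depth : ∀ v → Within (depth v) v
    within-depth v = proj₁ (proj₂ (least-depth v))

    depth-least : ∀ {k v} → Within k v → depth v ≤ k
    depth-least {v = v} = proj₂ (proj₂ (least-depth v))

    depth-zero : ∀ {v} → depth v ≡ 0 → v ≡ r
    depth-zero {v} e = subst (λ k → Within k v) e (within-depth v)

    depth-adj : ∀ {x y} → Adj x y → depth y ≤ suc (depth x)
    depth-adj a = depth-least (inj₂ (_ , within-depth _ , a))

    predecessor : ∀ {v k} → depth v ≡ suc k → ∃ λ w → Adj w v × depth w ≡ k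
    predecessor {v} {k} e with subst (λ j → Within j v) e (within-depth v)
    ... | inj₁ within-k = ⊥-elim (1+n≰n (subst (_≤ k) e (depth-least within-k)))
    ... | inj₂ (w , within-k , a) =
      w , a , ≤-antisym (depth-least within-k) (s≤s⁻¹ (subst (_≤ suc (depth w)) e (depth-adj a)))

    parent-at : ∀ {v} k → depth v ≡ k → Fin n
    parent-at zero _ = r
    parent-at (suc k) e = proj₁ (predecessor e)

    parent : Fin n → Fin n
    parent v = parent-at (depth v) refl

    parent-≡ : ∀ {v k} (e : depth v ≡ k) → parent v ≡ parent-at k e
    parent-≡ refl = refl

    parent-root : parent r ≡ r
    parent-root = parent-≡ (n≤0⇒n≡0 (depth-least refl))

    parent-step : ∀ {v k} → depth v ≡ suc k → Adj (parent v) v × depth (parent v) ≡ k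
    parent-step e rewrite parent-≡ e = proj₂ (predecessor e)

    shallower-∉ : ∀ {x k Q} → depth x ≡ k → All (λ z → suc k ≤ depth z) Q → All (x ≢_) Q
    shallower-∉ dx deeper = All.map (λ k<dz x≡z → <-irrefl (trans (sym dx) (cong depth x≡z)) k<dz) deeper

    -- Extend Q by the parents of its two ends until these coincide; the common parent closes a cycle.
    equal-depth-cycle : ∀ k {a b Q} → depth a ≡ k → depth b ≡ k → a ≢ b →
                        PathList G b a Q → Unique Q → All (λ z → k ≤ depth z) Q → HasCycle G
    equal-depth-cycle zero da db a≢b _ _ _ = ⊥-elim (a≢b (trans (depth-zero da) (sym (depth-zero db))))
    equal-depth-cycle (suc k) {a} {b} {Q} da db a≢b path uQ deep
      with parent-step da | parent-step db | parent a ≟ parent b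
    ... | pa-a , dpa | pb-b , dpb | yes pa≡pb =
      parent b , a , parent b ∷ Q , cons pb-b path , shallower-∉ dpb deep ∷ uQ ,
      s≤s (pathList-length path (≢-sym a≢b)) , subst (Adj a) pa≡pb (adj-sym pa-a)
    ... | pa-a , dpa | pb-b , dpb | no pa≢pb =
      equal-depth-cycle k dpa dpb pa≢pb (cons pb-b (pathList-∷ʳ path (adj-sym pa-a)))
        (Allₚ.∷ʳ⁺ (shallower-∉ dpb deep) (≢-sym pa≢pb) ∷ unique-∷ʳ uQ (All.map ≢-sym (shallower-∉ dpa deep)))
        (≤-reflexive (sym dpb) ∷ Allₚ.∷ʳ⁺ (All.map <⇒≤ deep) (≤-reflexive (sym dpa)))

    module _ (acyclic : Acyclic G) where

      adj⇒depth≢ : ∀ {x y} → Adj x y → depth x ≢ depth y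
      adj⇒depth≢ {x} {y} a dx≡dy = acyclic (equal-depth-cycle (depth x) refl (sym dx≡dy) (adj⇒≢ a)
        (cons (adj-sym a) one) ((≢-sym (adj⇒≢ a) ∷ []) ∷ [] ∷ []) (≤-reflexive dx≡dy ∷ ≤-refl ∷ []))

      parent-of-deeper : ∀ {x y} → Adj x y → depth x < depth y → parent y ≡ x
      parent-of-deeper {x} {y} a dx<dy with parent-step (≤-antisym (depth-adj a) dx<dy)
      ... | py-y , dpy with parent y ≟ x
      ...   | yes py≡x = py≡x
      ...   | no py≢x = ⊥-elim (acyclic (equal-depth-cycle (depth x) dpy refl py≢x
                (cons a (cons (adj-sym py-y) one))
                ((adj⇒≢ a ∷ ≢-sym py≢x ∷ []) ∷ (y≢py ∷ []) ∷ [] ∷ [])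
                (≤-refl ∷ <⇒≤ dx<dy ∷ ≤-reflexive (sym dpy) ∷ [])))
        where
          y≢py : y ≢ parent y
          y≢py y≡py = <-irrefl (trans (sym dpy) (cong depth (sym y≡py))) dx<dy

      rooting : Rooting r
      rooting = record
        { parent      = parent
        ; parent-root = parent-root
        ; parent-edge = λ {x} {y} a → edge a (<-cmp (depth x) (depth y))
        }
        where
          edge : ∀ {x y} → Adj x y → Tri (depth x < depth y) (depth x ≡ depth y) (depth y < depth x) →
                 parent x ≡ y ⊎ parent y ≡ x
          edge a (tri< dx<dy _ _) = inj₂ (parent-of-deeper a dx<dy)
          edge a (tri≈ _ dx≡dy _) = ⊥-elim (adj⇒depth≢ a dx≡dy)
          edge a (tri> _ _ dy<dx) = inj₁ (parent-of-deeper (adj-sym a) dy<dx)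

  tree-rooting : IsTree G → (r : Fin n) → Rooting r
  tree-rooting (connected , acyclic) r = Depth.rooting connected r acyclic

module _ {n : ℕ} {K : Set} (p : Subset n) (Owns : K → Fin n → Set) where

  record Cluster (c : ℕ) (k : K) : Set where
    field
      members  : List (Fin n)
      size     : length members ≡ c
      distinct : Unique members
      owned    : All (λ y → y ∈ p × Owns k y) members
  open Cluster

  clusters-fit : (∀ {k k' y} → Owns k y → Owns k' y → k ≡ k') →
                 ∀ {c ks} → Unique ks → All (Cluster c) ks → c * length ks ≤ ∣ p ∣
  clusters-fit owner-unique {c} uks cs =
    subst (_≤ ∣ p ∣) (union-length cs) (unique⇒length≤∣p∣ (union-unique uks cs) (All.map proj₁ (union-owned cs)))
    where
      union : ∀ {ks} → All (Cluster c) ks → List (Fin n)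
      union [] = []
      union (C ∷ cs) = members C ++ union cs

      union-length : ∀ {ks} (cs : All (Cluster c) ks) → length (union cs) ≡ c * length ks
      union-length [] = sym (*-zeroʳ c)
      union-length (C ∷ cs) =
        trans (length-++ (members C)) (trans (cong₂ _+_ (size C) (union-length cs)) (sym (*-suc c _)))

      union-owned : ∀ {ks} (cs : All (Cluster c) ks) → All (λ y → y ∈ p × ∃ λ k → k ∈ˡ ks × Owns k y) (union cs)
      union-owned [] = []
      union-owned (C ∷ cs) =
        Allₚ.++⁺ (All.map (λ (y∈p , own) → y∈p , _ , here refl , own) (owned C))
                (All.map (λ (y∈p , k , k∈ks , own) → y∈p , k , there k∈ks , own) (union-owned cs))

      union-unique : ∀ {ks} → Unique ks → (cs : All (Cluster c) ks) → Unique (union cs)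
      union-unique [] [] = []
      union-unique (k∉ks ∷ uks) (C ∷ cs) = ++⁺ (distinct C) (union-unique uks cs) disjoint
        where
          disjoint : ∀ {y} → ¬ (y ∈ˡ members C × y ∈ˡ union cs)
          disjoint (y∈C , y∈cs) with All.lookup (owned C) y∈C | All.lookup (union-owned cs) y∈cs
          ... | _ , own | _ , k' , k'∈ks , own' = All.lookup k∉ks k'∈ks (owner-unique own own')

module RedundantCode {n : ℕ} (G : Graph n) {r : Fin n} (R : Rooting G r)
                     (S : Subset n) (code : IsRedundantIC G S) (r∈S : r ∈ S) where
  open Graph G renaming (sym to adj-sym)
  open Rooting R

  NS : Fin n → Subset n
  NS v = N[_] G v ∩ S

  ∈NS⁻ : ∀ {y v} → y ∈ NS v → (y ≡ v ⊎ Adj y v) × y ∈ S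
  ∈NS⁻ {v = v} y∈ with x∈p∩q⁻ (N[_] G v) S y∈
  ... | y∈N , y∈S = ∈N[]⁻ G y∈N , y∈S

  ∈NS⁺ : ∀ {y v} → y ≡ v ⊎ Adj y v → y ∈ S → y ∈ NS v
  ∈NS⁺ h y∈S = x∈p∩q⁺ (∈N[]⁺ G h , y∈S)

  child-of : ∀ {p y} → Adj p y → y ≢ parent p → parent y ≡ p
  child-of a y≢pp with parent-edge a
  ... | inj₁ pp≡y = ⊥-elim (y≢pp (sym pp≡y))
  ... | inj₂ py≡p = py≡p

  Top : Fin n → Set
  Top t = t ≡ r ⊎ parent t ∉ S

  open Ascent parent Top

  top-child : ∀ {t y} → Top t → y ∈ S → Adj t y → parent y ≡ t
  top-child (inj₁ refl) _ a = child-of a λ y≡pr → adj⇒≢ G a (sym (trans y≡pr parent-root))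
  top-child (inj₂ pt∉S) y∈S a = child-of a λ y≡pt → pt∉S (subst (_∈ S) y≡pt y∈S)

  child-⇝ : ∀ {p y t} → Adj p y → parent y ≡ p → p ∈ S → p ⇝ t → y ⇝ t
  child-⇝ {p} {y} {t} a py≡p p∈S p⇝t = climb not-top (subst (_⇝ t) (sym py≡p) p⇝t)
    where
      not-top : ¬ Top y
      not-top (inj₁ refl) = adj⇒≢ G a (trans (sym py≡p) parent-root)
      not-top (inj₂ py∉S) = py∉S (subst (_∈ S) (sym py≡p) p∈S)

  Δ-below : ∀ {t a y} → Top t → t ∈ S → a ∈ S → Adj t a →
            y ∈ _Δ_ G (NS t) (NS a) → y ∈ S × y ≢ t × y ≢ a × y ⇝ t
  Δ-below {t} {a} t-top t∈S a∈S t-a y∈Δ with x∈p∪q⁻ _ _ y∈Δ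
  ... | inj₁ y∈t─a with ∈NS⁻ (p─q⊆p _ _ y∈t─a) | x∈p─q⇒x∉q y∈t─a
  ...   | inj₁ refl , _ | y∉NSa = ⊥-elim (y∉NSa (∈NS⁺ (inj₂ t-a) t∈S))
  ...   | inj₂ y-t , y∈S | y∉NSa =
    y∈S , adj⇒≢ G y-t , (λ { refl → y∉NSa (∈NS⁺ (inj₁ refl) a∈S) }) ,
    child-⇝ (adj-sym y-t) (top-child t-top y∈S (adj-sym y-t)) t∈S stop
  Δ-below {t} {a} {y} t-top t∈S a∈S t-a y∈Δ | inj₂ y∈a─t with ∈NS⁻ (p─q⊆p _ _ y∈a─t) | x∈p─q⇒x∉q y∈a─t
  ...   | inj₁ refl , _ | y∉NSt = ⊥-elim (y∉NSt (∈NS⁺ (inj₂ (adj-sym t-a)) a∈S))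
  ...   | inj₂ y-a , y∈S | y∉NSt =
    y∈S , y≢t , adj⇒≢ G y-a ,
    child-⇝ (adj-sym y-a) (child-of (adj-sym y-a) (λ y≡pa → y≢t (trans y≡pa pa≡t))) a∈S (child-⇝ t-a pa≡t t∈S stop)
    where
      pa≡t : parent a ≡ t
      pa≡t = top-child t-top a∈S t-a
      y≢t : y ≢ t
      y≢t refl = y∉NSt (∈NS⁺ (inj₁ refl) t∈S)

  -- The cluster of a top t is indexed by parent t: r indexes its own cluster, as parent r ≡ r.
  Owns : Fin n → Fin n → Set
  Owns u y = ∃ λ t → Top t × parent t ≡ u × y ⇝ t

  owner-unique : ∀ {u u' y} → Owns u y → Owns u' y → u ≡ u'
  owner-unique (t , t-top , pt≡u , y⇝t) (t' , t'-top , pt'≡u' , y⇝t') =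
    trans (sym pt≡u) (trans (cong parent (⇝-functional y⇝t y⇝t' t-top t'-top)) pt'≡u')

  cluster-with-child : ∀ {t a} → Top t → t ∈ S → a ∈ S → Adj t a → Cluster S Owns 4 (parent t)
  cluster-with-child {t} {a} t-top t∈S a∈S t-a
    with distinct-pair (_Δ_ G (NS t) (NS a)) (proj₂ code t a (adj⇒≢ G t-a))
  ... | y , z , y∈Δ , z∈Δ , y≢z with Δ-below t-top t∈S a∈S t-a y∈Δ | Δ-below t-top t∈S a∈S t-a z∈Δ
  ...   | y∈S , y≢t , y≢a , y⇝t | z∈S , z≢t , z≢a , z⇝t = record
    { members  = t ∷ a ∷ y ∷ z ∷ []
    ; size     = refl
    ; distinct = (adj⇒≢ G t-a ∷ ≢-sym y≢t ∷ ≢-sym z≢t ∷ []) ∷ (≢-sym y≢a ∷ ≢-sym z≢a ∷ []) ∷ (y≢z ∷ []) ∷ [] ∷ []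
    ; owned    = (t∈S , owned stop) ∷ (a∈S , owned a⇝t) ∷ (y∈S , owned y⇝t) ∷ (z∈S , owned z⇝t) ∷ []
    }
    where
      owned : ∀ {x} → x ⇝ t → Owns (parent t) x
      owned x⇝t = t , t-top , refl , x⇝t
      a⇝t : a ⇝ t
      a⇝t = child-⇝ t-a (top-child t-top a∈S t-a) t∈S stop

  cluster : ∀ {t} → Top t → t ∈ S → Cluster S Owns 4 (parent t)
  cluster {t} t-top t∈S with another-element (NS t) (proj₁ code t) t
  ... | a , a∈NSt , a≢t with ∈NS⁻ a∈NSt
  ...   | inj₁ a≡t , _ = ⊥-elim (a≢t a≡t)
  ...   | inj₂ a-t , a∈S = cluster-with-child t-top t∈S a∈S (adj-sym a-t)

  orphan-cluster : ∀ {u} → u ∉ S → Cluster S Owns 4 u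
  orphan-cluster {u} u∉S with another-element (NS u) (proj₁ code u) (parent u)
  ... | t , t∈NSu , t≢pu with ∈NS⁻ t∈NSu
  ...   | inj₁ refl , t∈S = ⊥-elim (u∉S t∈S)
  ...   | inj₂ t-u , t∈S = subst (Cluster S Owns 4) pt≡u (cluster (inj₂ (subst (_∉ S) (sym pt≡u) u∉S)) t∈S)
    where
      pt≡u : parent t ≡ u
      pt≡u = child-of (adj-sym t-u) t≢pu

  orphans : List (Fin n)
  orphans = filter (∁? (_∈? S)) (allFin n)

  clusters-in-S : 4 * suc (length orphans) ≤ ∣ S ∣
  clusters-in-S = clusters-fit S Owns owner-unique
    (All.tabulate r∉orphans ∷ filter⁺ (∁? (_∈? S)) (allFin⁺ n))
    (subst (Cluster S Owns 4) parent-root (cluster (inj₁ refl) r∈S) ∷ All.map orphan-cluster (Allₚ.all-filter (∁? (_∈? S)) (allFin n)))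
    where
      r∉orphans : ∀ {u} → u ∈ˡ orphans → r ≢ u
      r∉orphans u∈ refl = proj₂ (∈-filter⁻ (∁? (_∈? S)) {xs = allFin n} u∈) r∈S

  code-size : ⌈ 4 * (n + 1) /5⌉ ≤ ∣ S ∣
  code-size = ⌈/5⌉-least (begin
    4 * (n + 1)                        ≡⟨ cong (λ m → 4 * (m + 1)) (sym vertices-split) ⟩
    4 * (length inS + length orphans + 1) ≡⟨ distrib (length inS) (length orphans) ⟩
    4 * length inS + 4 * suc (length orphans) ≤⟨ +-mono-≤ (*-monoʳ-≤ 4 inS≤∣S∣) clusters-in-S ⟩
    4 * ∣ S ∣ + ∣ S ∣                  ≡⟨ +-comm (4 * ∣ S ∣) ∣ S ∣ ⟩
    5 * ∣ S ∣                          ∎)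
    where
      open ≤-Reasoning
      inS : List (Fin n)
      inS = filter (_∈? S) (allFin n)
      inS≤∣S∣ : length inS ≤ ∣ S ∣
      inS≤∣S∣ = unique⇒length≤∣p∣ (filter⁺ (_∈? S) (allFin⁺ n)) (Allₚ.all-filter (_∈? S) (allFin n))
      vertices-split : length inS + length orphans ≡ n
      vertices-split = trans (length-filter-∁ (_∈? S) (allFin n)) (length-tabulate id)
      distrib : ∀ a b → 4 * (a + b + 1) ≡ 4 * a + 4 * suc b
      distrib = solve-∀

redundant-code-size : ∀ {n} (G : Graph n) → IsTree G → ∀ {S} → IsRedundantIC G S → Fin n → ⌈ 4 * (n + 1) /5⌉ ≤ ∣ S ∣
redundant-code-size G tree {S} code v with another-element (N[_] G v ∩ S) (proj₁ code v) v
... | r , r∈NSv , _ = RedundantCode.code-size G (tree-rooting G tree r) S code (proj₂ (x∈p∩q⁻ (N[_] G v) S r∈NSv))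

theorem7 : (n : ℕ) → 4 ≤ n → (T : Graph n) → IsTree T → HasRedundantIC T →
  (k : ℕ) → IsREDIC T k → (⌈ 4 * (n + 1) /5⌉ ≤ k) × (k ≤ n)
theorem7 zero () _ _ _ _ _
theorem7 (suc n) _ T tree _ k ((S , code , ∣S∣≡k) , _) =
  subst (⌈ 4 * (suc n + 1) /5⌉ ≤_) ∣S∣≡k (redundant-code-size T tree {S} code Fin.zero) ,
  subst (_≤ suc n) ∣S∣≡k (∣p∣≤n S)
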